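{- Let $\mathcal{H}$ be an $r$-uniform $r$-partite linear hypergraph ($r\ge 3$). If $\mathcal{H}$ is $\mathcal{G}_r(3r-3,3)$-free, then it is also $\mathcal{G}_r(4r-5,4)$-free.
   Context: A hypergraph is linear if any two distinct edges share at most one vertex. An $r$-uniform hypergraph is $r$-partite if its vertex set is partitioned into $r$ parts such that every edge contains exactly one vertex of each part. An $r$-uniform hypergraph is $\mathcal{G}_r(v,e)$-free if the union of any $e$ distinct edges has at least $v+1$ vertices. -}

module Defs where

open import Data.Nat using (ℕ; _≤_; _<_; _+_)
open import Data.Fin using (Fin)
open import Data.Fin.Subset using (Subset; _∈_; _∩_; ⋃; ∣_∣)
open import Data.Fin.Subset.Properties using (_∈?_)
open import Data.List using (List; filter)
open import Data.Product using (Σ; ∃; _×_)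
open import Relation.Binary.PropositionalEquality using (_≡_; _≢_)
open import Function.Definitions using (Injective)
import Data.List as L

-- A (finite) hypergraph on vertex set Fin n with m edges, given as a family
-- of vertex subsets E : Fin m → Subset n.  Edges are distinct: E injective.

edgeUnion : {n m : ℕ} → (Fin m → Subset n) → Subset m → Subset n
edgeUnion {m = m} E S = ⋃ (L.map E (filter (_∈? S) (L.allFin m)))

DistinctEdges : {n m : ℕ} → (Fin m → Subset n) → Set
DistinctEdges E = Injective _≡_ _≡_ E

Uniform : {n m : ℕ} → ℕ → (Fin m → Subset n) → Set
Uniform r E = ∀ i → ∣ E i ∣ ≡ r

Partite : {n m : ℕ} → ℕ → (Fin m → Subset n) → Set
Partite {n} r E =
  Σ (Fin n → Fin r) λ part →
    ∀ i (k : Fin r) → Σ (Fin n) λ x →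
      (x ∈ E i) × (part x ≡ k) × (∀ y → y ∈ E i → part y ≡ k → y ≡ x)

Linear : {n m : ℕ} → (Fin m → Subset n) → Set
Linear E = ∀ i j → i ≢ j → ∣ E i ∩ E j ∣ ≤ 1

GFree : {n m : ℕ} → (Fin m → Subset n) → ℕ → ℕ → Set
GFree E v e = ∀ S → ∣ S ∣ ≡ e → v + 1 ≤ ∣ edgeUnion E S ∣

module Submission where

-- Take four distinct edges A, B, C, D and put V = B ∪ C ∪ D and I = A ∩ V,
-- so that |A ∪ V| = r + |V| − |I|, where I is covered by the three traces
-- A∩B, A∩C, A∩D, each of size ≤ 1 by linearity.
--   * If |I| ≤ 2, the triple bound |V| ≥ 3r − 2 already gives |A ∪ V| ≥ 4r − 4.
--   * If |I| = 3, every two traces are disjoint points.  For two of the other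
--     edges P, Q this forces P ∩ Q = ∅, since otherwise |A ∪ P ∪ Q| =
--     r + (2r − 1) − 2 = 3r − 3 would violate the triple bound.

open import Defs
open import Algebra.Bundles using (CommutativeMonoid)
import Algebra.Properties.CommutativeSemigroup as CommutativeSemigroupProperties
open import Data.Nat using (ℕ; zero; suc; _≤_; _+_; _∸_; _*_)
open import Data.Nat.Properties
open import Data.Nat.Tactic.RingSolver using (solve-∀)
open import Data.Fin using (Fin; zero; suc)
open import Data.Fin.Subset
open import Data.Fin.Subset.Properties
open import Data.List using (List; []; _∷_; allFin)
open import Data.Vec using ([]; _∷_; here; there)
import Data.List.Membership.Propositional as List
open import Data.List.Membership.Propositional.Properties
  using (∈-map⁺; ∈-map⁻; ∈-filter⁺; ∈-filter⁻; ∈-allFin)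
open import Data.List.Relation.Unary.Any using (here; there)
open import Data.Product using (Σ-syntax; _×_; _,_; proj₂)
open import Data.Sum using (inj₁; inj₂)
open import Relation.Binary.PropositionalEquality
open import Relation.Nullary using (yes; no)
open import Relation.Nullary.Negation using (contradiction)

module ∪-Reorder {n : ℕ} = CommutativeSemigroupProperties
  (CommutativeMonoid.commutativeSemigroup (∪-commutativeMonoid n))

∣p∪q∣+∣p∩q∣ : ∀ {n} (p q : Subset n) → ∣ p ∪ q ∣ + ∣ p ∩ q ∣ ≡ ∣ p ∣ + ∣ q ∣
∣p∪q∣+∣p∩q∣ []            []            = refl
∣p∪q∣+∣p∩q∣ (inside ∷ p)  (inside ∷ q)  =
  cong suc (trans (+-suc _ _) (trans (cong suc (∣p∪q∣+∣p∩q∣ p q)) (sym (+-suc _ _))))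
∣p∪q∣+∣p∩q∣ (inside ∷ p)  (outside ∷ q) = cong suc (∣p∪q∣+∣p∩q∣ p q)
∣p∪q∣+∣p∩q∣ (outside ∷ p) (inside ∷ q)  =
  trans (cong suc (∣p∪q∣+∣p∩q∣ p q)) (sym (+-suc _ _))
∣p∪q∣+∣p∩q∣ (outside ∷ p) (outside ∷ q) = ∣p∪q∣+∣p∩q∣ p q

∣p∪q∣≤∣p∣+∣q∣ : ∀ {n} (p q : Subset n) → ∣ p ∪ q ∣ ≤ ∣ p ∣ + ∣ q ∣
∣p∪q∣≤∣p∣+∣q∣ p q = subst (∣ p ∪ q ∣ ≤_) (∣p∪q∣+∣p∩q∣ p q) (m≤m+n _ _)

∣p∪q∣-disjoint : ∀ {n} (p q : Subset n) → ∣ p ∩ q ∣ ≡ 0 → ∣ p ∪ q ∣ ≡ ∣ p ∣ + ∣ q ∣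
∣p∪q∣-disjoint p q p∩q≡0 = begin
  ∣ p ∪ q ∣             ≡⟨ sym (+-identityʳ _) ⟩
  ∣ p ∪ q ∣ + 0         ≡⟨ cong (∣ p ∪ q ∣ +_) (sym p∩q≡0) ⟩
  ∣ p ∪ q ∣ + ∣ p ∩ q ∣ ≡⟨ ∣p∪q∣+∣p∩q∣ p q ⟩
  ∣ p ∣ + ∣ q ∣         ∎
  where open ≡-Reasoning

∣p∪q∪s∣-disjoint : ∀ {n} (p q s : Subset n) →
  ∣ p ∩ q ∣ ≡ 0 → ∣ p ∩ s ∣ ≡ 0 → ∣ q ∩ s ∣ ≡ 0 →
  ∣ p ∪ (q ∪ s) ∣ ≡ ∣ p ∣ + (∣ q ∣ + ∣ s ∣)
∣p∪q∪s∣-disjoint p q s p∩q≡0 p∩s≡0 q∩s≡0 =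
  trans (∣p∪q∣-disjoint p (q ∪ s) p∩[q∪s]≡0) (cong (∣ p ∣ +_) (∣p∪q∣-disjoint q s q∩s≡0))
  where
  p∩[q∪s]≡0 : ∣ p ∩ (q ∪ s) ∣ ≡ 0
  p∩[q∪s]≡0 = n≤0⇒n≡0 (begin
    ∣ p ∩ (q ∪ s) ∣           ≡⟨ cong ∣_∣ (∩-distribˡ-∪ p q s) ⟩
    ∣ (p ∩ q) ∪ (p ∩ s) ∣     ≤⟨ ∣p∪q∣≤∣p∣+∣q∣ (p ∩ q) (p ∩ s) ⟩
    ∣ p ∩ q ∣ + ∣ p ∩ s ∣     ≡⟨ cong₂ _+_ p∩q≡0 p∩s≡0 ⟩
    0                         ∎)
    where open ≤-Reasoning

∣p∪q∣≡2 : ∀ {n} (p q s : Subset n) → ∣ p ∣ ≤ 1 → ∣ q ∣ ≤ 1 → ∣ s ∣ ≤ 1 →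
  ∣ s ∪ (p ∪ q) ∣ ≡ 3 → ∣ p ∪ q ∣ ≡ 2
∣p∪q∣≡2 p q s ∣p∣≤1 ∣q∣≤1 ∣s∣≤1 ∣s∪p∪q∣≡3 = ≤-antisym atMost2 atLeast2
  where
  atMost2 : ∣ p ∪ q ∣ ≤ 2
  atMost2 = ≤-trans (∣p∪q∣≤∣p∣+∣q∣ p q) (+-mono-≤ ∣p∣≤1 ∣q∣≤1)
  atLeast2 : 2 ≤ ∣ p ∪ q ∣
  atLeast2 = +-cancelˡ-≤ 1 2 ∣ p ∪ q ∣ (begin
    3                     ≡⟨ sym ∣s∪p∪q∣≡3 ⟩
    ∣ s ∪ (p ∪ q) ∣       ≤⟨ ∣p∪q∣≤∣p∣+∣q∣ s (p ∪ q) ⟩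
    ∣ s ∣ + ∣ p ∪ q ∣     ≤⟨ +-monoˡ-≤ ∣ p ∪ q ∣ ∣s∣≤1 ⟩
    1 + ∣ p ∪ q ∣         ∎)
    where open ≤-Reasoning

∣p∣≡0⇒p≡⊥ : ∀ {n} (p : Subset n) → ∣ p ∣ ≡ 0 → p ≡ ⊥
∣p∣≡0⇒p≡⊥ []            _     = refl
∣p∣≡0⇒p≡⊥ (outside ∷ p) ∣p∣≡0 = cong (outside ∷_) (∣p∣≡0⇒p≡⊥ p ∣p∣≡0)

∣⁅i⁆∪p∣ : ∀ {n} (i : Fin n) (p : Subset n) → i ∉ p → ∣ ⁅ i ⁆ ∪ p ∣ ≡ suc ∣ p ∣
∣⁅i⁆∪p∣ zero    (inside ∷ p)  i∉p = contradiction here i∉p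
∣⁅i⁆∪p∣ zero    (outside ∷ p) i∉p = cong (λ q → suc ∣ q ∣) (∪-identityˡ p)
∣⁅i⁆∪p∣ (suc i) (inside ∷ p)  i∉p = cong suc (∣⁅i⁆∪p∣ i p (λ i∈p → i∉p (there i∈p)))
∣⁅i⁆∪p∣ (suc i) (outside ∷ p) i∉p = ∣⁅i⁆∪p∣ i p (λ i∈p → i∉p (there i∈p))

peel : ∀ {n k} (p : Subset n) → ∣ p ∣ ≡ suc k →
  Σ[ i ∈ Fin n ] Σ[ q ∈ Subset n ] i ∉ q × p ≡ ⁅ i ⁆ ∪ q × ∣ q ∣ ≡ k
peel (inside ∷ p)  ∣p∣≡1+k =
  zero , outside ∷ p , (λ ()) , cong (inside ∷_) (sym (∪-identityˡ p)) , suc-injective ∣p∣≡1+k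
peel (outside ∷ p) ∣p∣≡1+k with peel p ∣p∣≡1+k
... | i , q , i∉q , refl , ∣q∣≡k =
  suc i , outside ∷ q , (λ { (there i∈q) → i∉q i∈q }) , refl , ∣q∣≡k

∉-head : ∀ {n} {i j : Fin n} {p : Subset n} → i ∉ ⁅ j ⁆ ∪ p → i ≢ j
∉-head {j = j} i∉ refl = i∉ (x∈p∪q⁺ (inj₁ (x∈⁅x⁆ j)))

∉-tail : ∀ {n} {i : Fin n} {q p : Subset n} → i ∉ q ∪ p → i ∉ p
∉-tail i∉ i∈p = i∉ (x∈p∪q⁺ (inj₂ i∈p))

∣⁅i,j,k⁆∣ : ∀ {n} {i j k : Fin n} → i ≢ j → i ≢ k → j ≢ k → ∣ ⁅ i ⁆ ∪ (⁅ j ⁆ ∪ ⁅ k ⁆) ∣ ≡ 3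
∣⁅i,j,k⁆∣ {i = i} {j} {k} i≢j i≢k j≢k =
  trans (∣⁅i⁆∪p∣ i _ i∉⁅j,k⁆)
        (cong suc (trans (∣⁅i⁆∪p∣ j ⁅ k ⁆ (x≢y⇒x∉⁅y⁆ j≢k)) (cong suc (∣⁅x⁆∣≡1 k))))
  where
  i∉⁅j,k⁆ : i ∉ ⁅ j ⁆ ∪ ⁅ k ⁆
  i∉⁅j,k⁆ i∈ with x∈p∪q⁻ ⁅ j ⁆ ⁅ k ⁆ i∈
  ... | inj₁ i∈⁅j⁆ = i≢j (x∈⁅y⁆⇒x≡y j i∈⁅j⁆)
  ... | inj₂ i∈⁅k⁆ = i≢k (x∈⁅y⁆⇒x≡y k i∈⁅k⁆)

record Distinct4 (m : ℕ) : Set where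
  field
    a b c d : Fin m
    a≢b : a ≢ b
    a≢c : a ≢ c
    a≢d : a ≢ d
    b≢c : b ≢ c
    b≢d : b ≢ d
    c≢d : c ≢ d

  set : Subset m
  set = ⁅ a ⁆ ∪ (⁅ b ⁆ ∪ (⁅ c ⁆ ∪ ⁅ d ⁆))

split4 : ∀ {m} (p : Subset m) → ∣ p ∣ ≡ 4 → Σ[ q ∈ Distinct4 m ] p ≡ Distinct4.set q
split4 p ∣p∣≡4 with peel p ∣p∣≡4
... | a , p₁ , a∉ , refl , ∣p₁∣≡3 with peel p₁ ∣p₁∣≡3
... | b , p₂ , b∉ , refl , ∣p₂∣≡2 with peel p₂ ∣p₂∣≡2
... | c , p₃ , c∉ , refl , ∣p₃∣≡1 with peel p₃ ∣p₃∣≡1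
... | d , p₄ , _  , refl , ∣p₄∣≡0 = distinct , cong (λ s → ⁅ a ⁆ ∪ (⁅ b ⁆ ∪ (⁅ c ⁆ ∪ s))) ⁅d⁆∪p₄≡⁅d⁆
  where
  ⁅d⁆∪p₄≡⁅d⁆ : ⁅ d ⁆ ∪ p₄ ≡ ⁅ d ⁆
  ⁅d⁆∪p₄≡⁅d⁆ = trans (cong (⁅ d ⁆ ∪_) (∣p∣≡0⇒p≡⊥ p₄ ∣p₄∣≡0)) (∪-identityʳ ⁅ d ⁆)
  distinct : Distinct4 _
  distinct = record
    { a = a ; b = b ; c = c ; d = d
    ; a≢b = ∉-head a∉ ; a≢c = ∉-head (∉-tail a∉) ; a≢d = ∉-head (∉-tail (∉-tail a∉))
    ; b≢c = ∉-head b∉ ; b≢d = ∉-head (∉-tail b∉)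
    ; c≢d = ∉-head c∉
    }

-- The number of points of three disjoint r-sets, in the grouping produced by unions.
3*r≡r+[r+r] : ∀ r → 3 * r ≡ r + (r + r)
3*r≡r+[r+r] = solve-∀

-- If
-- the three sets span at least 3r − 2 points, then P and Q are disjoint:
-- each common point of P and Q would lower the span by one.
disjoint-below-apex : ∀ {n} r (A P Q : Subset n) → ∣ A ∣ ≡ r → ∣ P ∣ ≡ r → ∣ Q ∣ ≡ r →
  ∣ (A ∩ P) ∪ (A ∩ Q) ∣ ≡ 2 → 3 * r ≤ ∣ A ∪ (P ∪ Q) ∣ + 2 → ∣ P ∩ Q ∣ ≡ 0
disjoint-below-apex r A P Q ∣A∣≡r ∣P∣≡r ∣Q∣≡r ∣traces∣≡2 spread =
  n≤0⇒n≡0 (+-cancelˡ-≤ (∣ U ∣ + 2) ∣ P ∩ Q ∣ 0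
    (≤-trans (≤-reflexive span+overlap) (≤-trans spread (≤-reflexive (sym (+-identityʳ _))))))
  where
  open ≡-Reasoning
  U : Subset _
  U = A ∪ (P ∪ Q)
  ∣A∩[P∪Q]∣≡2 : ∣ A ∩ (P ∪ Q) ∣ ≡ 2
  ∣A∩[P∪Q]∣≡2 = trans (cong ∣_∣ (∩-distribˡ-∪ A P Q)) ∣traces∣≡2
  span+overlap : ∣ U ∣ + 2 + ∣ P ∩ Q ∣ ≡ 3 * r
  span+overlap = begin
    ∣ U ∣ + 2 + ∣ P ∩ Q ∣                 ≡⟨ cong (λ t → ∣ U ∣ + t + ∣ P ∩ Q ∣) (sym ∣A∩[P∪Q]∣≡2) ⟩
    ∣ U ∣ + ∣ A ∩ (P ∪ Q) ∣ + ∣ P ∩ Q ∣   ≡⟨ cong (_+ ∣ P ∩ Q ∣) (∣p∪q∣+∣p∩q∣ A (P ∪ Q)) ⟩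
    ∣ A ∣ + ∣ P ∪ Q ∣ + ∣ P ∩ Q ∣         ≡⟨ trans (+-assoc ∣ A ∣ _ _) (cong (∣ A ∣ +_) (∣p∪q∣+∣p∩q∣ P Q)) ⟩
    ∣ A ∣ + (∣ P ∣ + ∣ Q ∣)               ≡⟨ cong₂ (λ x y → x + (y + ∣ Q ∣)) ∣A∣≡r ∣P∣≡r ⟩
    r + (r + ∣ Q ∣)                       ≡⟨ cong (λ z → r + (r + z)) ∣Q∣≡r ⟩
    r + (r + r)                           ≡⟨ sym (3*r≡r+[r+r] r) ⟩
    3 * r                                 ∎

module FourSets {n : ℕ} (r : ℕ) (A B C D : Subset n)
  (∣A∣≡r : ∣ A ∣ ≡ r) (∣B∣≡r : ∣ B ∣ ≡ r) (∣C∣≡r : ∣ C ∣ ≡ r) (∣D∣≡r : ∣ D ∣ ≡ r)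
  (∣A∩B∣≤1 : ∣ A ∩ B ∣ ≤ 1) (∣A∩C∣≤1 : ∣ A ∩ C ∣ ≤ 1) (∣A∩D∣≤1 : ∣ A ∩ D ∣ ≤ 1)
  (spreadBCD : 3 * r ≤ ∣ B ∪ (C ∪ D) ∣ + 2) (spreadABC : 3 * r ≤ ∣ A ∪ (B ∪ C) ∣ + 2)
  (spreadABD : 3 * r ≤ ∣ A ∪ (B ∪ D) ∣ + 2) (spreadACD : 3 * r ≤ ∣ A ∪ (C ∪ D) ∣ + 2)
  where

  V : Subset n
  V = B ∪ (C ∪ D)

  I : Subset n
  I = A ∩ V

  I≡traces : I ≡ (A ∩ B) ∪ ((A ∩ C) ∪ (A ∩ D))
  I≡traces = trans (∩-distribˡ-∪ A B (C ∪ D)) (cong ((A ∩ B) ∪_) (∩-distribˡ-∪ A C D))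

  ∣I∣≤3 : ∣ I ∣ ≤ 3
  ∣I∣≤3 = begin
    ∣ I ∣                                         ≡⟨ cong ∣_∣ I≡traces ⟩
    ∣ (A ∩ B) ∪ ((A ∩ C) ∪ (A ∩ D)) ∣             ≤⟨ ∣p∪q∣≤∣p∣+∣q∣ (A ∩ B) _ ⟩
    ∣ A ∩ B ∣ + ∣ (A ∩ C) ∪ (A ∩ D) ∣             ≤⟨ +-monoʳ-≤ ∣ A ∩ B ∣ (∣p∪q∣≤∣p∣+∣q∣ (A ∩ C) (A ∩ D)) ⟩
    ∣ A ∩ B ∣ + (∣ A ∩ C ∣ + ∣ A ∩ D ∣)           ≤⟨ +-mono-≤ ∣A∩B∣≤1 (+-mono-≤ ∣A∩C∣≤1 ∣A∩D∣≤1) ⟩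
    3                                             ∎
    where open ≤-Reasoning

  -- If A meets B, C, D in three distinct points, then B, C, D are pairwise
  -- disjoint (by disjoint-below-apex), so V has exactly 3r points.
  ∣V∣≡3r : ∣ I ∣ ≡ 3 → ∣ V ∣ ≡ 3 * r
  ∣V∣≡3r ∣I∣≡3 = begin
    ∣ V ∣                       ≡⟨ ∣p∪q∪s∣-disjoint B C D B∩C≡0 B∩D≡0 C∩D≡0 ⟩
    ∣ B ∣ + (∣ C ∣ + ∣ D ∣)     ≡⟨ cong₂ _+_ ∣B∣≡r (cong₂ _+_ ∣C∣≡r ∣D∣≡r) ⟩
    r + (r + r)                 ≡⟨ sym (3*r≡r+[r+r] r) ⟩
    3 * r                       ∎
    where
    open ≡-Reasoning
    X = A ∩ B
    Y = A ∩ C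
    Z = A ∩ D
    ∣X∪Y∪Z∣≡3 : ∣ X ∪ (Y ∪ Z) ∣ ≡ 3
    ∣X∪Y∪Z∣≡3 = trans (cong ∣_∣ (sym I≡traces)) ∣I∣≡3
    ∣X∪Y∣≡2 : ∣ X ∪ Y ∣ ≡ 2
    ∣X∪Y∣≡2 = ∣p∪q∣≡2 X Y Z ∣A∩B∣≤1 ∣A∩C∣≤1 ∣A∩D∣≤1
      (trans (cong ∣_∣ (sym (∪-Reorder.x∙yz≈z∙xy X Y Z))) ∣X∪Y∪Z∣≡3)
    ∣X∪Z∣≡2 : ∣ X ∪ Z ∣ ≡ 2
    ∣X∪Z∣≡2 = ∣p∪q∣≡2 X Z Y ∣A∩B∣≤1 ∣A∩D∣≤1 ∣A∩C∣≤1
      (trans (cong ∣_∣ (∪-Reorder.x∙yz≈y∙xz Y X Z)) ∣X∪Y∪Z∣≡3)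
    ∣Y∪Z∣≡2 : ∣ Y ∪ Z ∣ ≡ 2
    ∣Y∪Z∣≡2 = ∣p∪q∣≡2 Y Z X ∣A∩C∣≤1 ∣A∩D∣≤1 ∣A∩B∣≤1 ∣X∪Y∪Z∣≡3
    B∩C≡0 : ∣ B ∩ C ∣ ≡ 0
    B∩C≡0 = disjoint-below-apex r A B C ∣A∣≡r ∣B∣≡r ∣C∣≡r ∣X∪Y∣≡2 spreadABC
    B∩D≡0 : ∣ B ∩ D ∣ ≡ 0
    B∩D≡0 = disjoint-below-apex r A B D ∣A∣≡r ∣B∣≡r ∣D∣≡r ∣X∪Z∣≡2 spreadABD
    C∩D≡0 : ∣ C ∩ D ∣ ≡ 0
    C∩D≡0 = disjoint-below-apex r A C D ∣A∣≡r ∣C∣≡r ∣D∣≡r ∣Y∪Z∣≡2 spreadACD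

  3r+∣I∣≤∣V∣+4 : 3 * r + ∣ I ∣ ≤ ∣ V ∣ + 4
  3r+∣I∣≤∣V∣+4 with ∣ I ∣ ≤? 2
  ... | yes ∣I∣≤2 = ≤-trans (+-mono-≤ spreadBCD ∣I∣≤2) (≤-reflexive (+-assoc ∣ V ∣ 2 2))
  ... | no  ∣I∣≰2 = begin
    3 * r + ∣ I ∣   ≡⟨ cong₂ _+_ (sym (∣V∣≡3r ∣I∣≡3)) ∣I∣≡3 ⟩
    ∣ V ∣ + 3       ≤⟨ +-monoʳ-≤ ∣ V ∣ (n≤1+n 3) ⟩
    ∣ V ∣ + 4       ∎
    where
    open ≤-Reasoning
    ∣I∣≡3 : ∣ I ∣ ≡ 3
    ∣I∣≡3 = ≤-antisym ∣I∣≤3 (≰⇒> ∣I∣≰2)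

  -- Adding A to V contributes r − |I| new points.
  bound : 4 * r ≤ ∣ A ∪ V ∣ + 4
  bound = +-cancelʳ-≤ ∣ I ∣ (4 * r) (∣ A ∪ V ∣ + 4) (begin
    4 * r + ∣ I ∣               ≡⟨ regroup r ∣ I ∣ ⟩
    r + (3 * r + ∣ I ∣)         ≤⟨ +-monoʳ-≤ r 3r+∣I∣≤∣V∣+4 ⟩
    r + (∣ V ∣ + 4)             ≡⟨ sym (+-assoc r ∣ V ∣ 4) ⟩
    r + ∣ V ∣ + 4               ≡⟨ cong (λ t → t + ∣ V ∣ + 4) (sym ∣A∣≡r) ⟩
    ∣ A ∣ + ∣ V ∣ + 4           ≡⟨ cong (_+ 4) (sym (∣p∪q∣+∣p∩q∣ A V)) ⟩
    ∣ A ∪ V ∣ + ∣ I ∣ + 4       ≡⟨ swap ∣ A ∪ V ∣ ∣ I ∣ 4 ⟩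
    ∣ A ∪ V ∣ + 4 + ∣ I ∣       ∎)
    where
    open ≤-Reasoning
    regroup : ∀ x y → 4 * x + y ≡ x + (3 * x + y)
    regroup = solve-∀
    swap : ∀ x y z → x + y + z ≡ x + z + y
    swap = solve-∀

∈⋃⁻ : ∀ {n} {x : Fin n} (ps : List (Subset n)) → x ∈ ⋃ ps →
  Σ[ p ∈ Subset n ] p List.∈ ps × x ∈ p
∈⋃⁻ []       x∈⋃ = contradiction x∈⋃ ∉⊥
∈⋃⁻ (p ∷ ps) x∈⋃ with x∈p∪q⁻ p (⋃ ps) x∈⋃
... | inj₁ x∈p = p , here refl , x∈p
... | inj₂ x∈⋃ps with ∈⋃⁻ ps x∈⋃ps
...   | q , q∈ps , x∈q = q , there q∈ps , x∈q

∈⋃⁺ : ∀ {n} {x : Fin n} {p : Subset n} (ps : List (Subset n)) → p List.∈ ps → x ∈ p → x ∈ ⋃ ps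
∈⋃⁺ (_ ∷ ps) (here refl) x∈p = x∈p∪q⁺ (inj₁ x∈p)
∈⋃⁺ (_ ∷ ps) (there p∈ps) x∈p = x∈p∪q⁺ (inj₂ (∈⋃⁺ ps p∈ps x∈p))

module _ {n m : ℕ} (E : Fin m → Subset n) where

  ∈-edgeUnion⁻ : ∀ {x} S → x ∈ edgeUnion E S → Σ[ i ∈ Fin m ] i ∈ S × x ∈ E i
  ∈-edgeUnion⁻ S x∈ with ∈⋃⁻ _ x∈
  ... | _ , p∈ , x∈p with ∈-map⁻ E p∈
  ...   | i , i∈ , refl = i , proj₂ (∈-filter⁻ (_∈? S) {xs = allFin m} i∈) , x∈p

  ∈-edgeUnion⁺ : ∀ {x} S i → i ∈ S → x ∈ E i → x ∈ edgeUnion E S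
  ∈-edgeUnion⁺ S i i∈S = ∈⋃⁺ _ (∈-map⁺ E (∈-filter⁺ (_∈? S) (∈-allFin i) i∈S))

  edgeUnion-∪ : ∀ S T → edgeUnion E (S ∪ T) ≡ edgeUnion E S ∪ edgeUnion E T
  edgeUnion-∪ S T = ⊆-antisym split join
    where
    split : edgeUnion E (S ∪ T) ⊆ edgeUnion E S ∪ edgeUnion E T
    split x∈ with ∈-edgeUnion⁻ (S ∪ T) x∈
    ... | i , i∈S∪T , x∈Ei with x∈p∪q⁻ S T i∈S∪T
    ...   | inj₁ i∈S = x∈p∪q⁺ (inj₁ (∈-edgeUnion⁺ S i i∈S x∈Ei))
    ...   | inj₂ i∈T = x∈p∪q⁺ (inj₂ (∈-edgeUnion⁺ T i i∈T x∈Ei))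
    join : edgeUnion E S ∪ edgeUnion E T ⊆ edgeUnion E (S ∪ T)
    join x∈ with x∈p∪q⁻ (edgeUnion E S) (edgeUnion E T) x∈
    ... | inj₁ x∈S with ∈-edgeUnion⁻ S x∈S
    ...   | i , i∈S , x∈Ei = ∈-edgeUnion⁺ (S ∪ T) i (x∈p∪q⁺ (inj₁ i∈S)) x∈Ei
    join x∈ | inj₂ x∈T with ∈-edgeUnion⁻ T x∈T
    ...   | i , i∈T , x∈Ei = ∈-edgeUnion⁺ (S ∪ T) i (x∈p∪q⁺ (inj₂ i∈T)) x∈Ei

  edgeUnion-⁅⁆ : ∀ i → edgeUnion E ⁅ i ⁆ ≡ E i
  edgeUnion-⁅⁆ i = ⊆-antisym only-i (∈-edgeUnion⁺ ⁅ i ⁆ i (x∈⁅x⁆ i))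
    where
    only-i : edgeUnion E ⁅ i ⁆ ⊆ E i
    only-i x∈ with ∈-edgeUnion⁻ ⁅ i ⁆ x∈
    ... | j , j∈⁅i⁆ , x∈Ej with x∈⁅y⁆⇒x≡y i j∈⁅i⁆
    ...   | refl = x∈Ej

  edgeUnion-⁅i,j,k⁆ : ∀ i j k → edgeUnion E (⁅ i ⁆ ∪ (⁅ j ⁆ ∪ ⁅ k ⁆)) ≡ E i ∪ (E j ∪ E k)
  edgeUnion-⁅i,j,k⁆ i j k = begin
    edgeUnion E (⁅ i ⁆ ∪ (⁅ j ⁆ ∪ ⁅ k ⁆))
      ≡⟨ edgeUnion-∪ ⁅ i ⁆ (⁅ j ⁆ ∪ ⁅ k ⁆) ⟩
    edgeUnion E ⁅ i ⁆ ∪ edgeUnion E (⁅ j ⁆ ∪ ⁅ k ⁆)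
      ≡⟨ cong (edgeUnion E ⁅ i ⁆ ∪_) (edgeUnion-∪ ⁅ j ⁆ ⁅ k ⁆) ⟩
    edgeUnion E ⁅ i ⁆ ∪ (edgeUnion E ⁅ j ⁆ ∪ edgeUnion E ⁅ k ⁆)
      ≡⟨ cong₂ _∪_ (edgeUnion-⁅⁆ i) (cong₂ _∪_ (edgeUnion-⁅⁆ j) (edgeUnion-⁅⁆ k)) ⟩
    E i ∪ (E j ∪ E k)
      ∎
    where open ≡-Reasoning

  edgeUnion-Distinct4 : (q : Distinct4 m) → let open Distinct4 q in
    edgeUnion E set ≡ E a ∪ (E b ∪ (E c ∪ E d))
  edgeUnion-Distinct4 q = trans (edgeUnion-∪ ⁅ a ⁆ (⁅ b ⁆ ∪ (⁅ c ⁆ ∪ ⁅ d ⁆)))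
    (cong₂ _∪_ (edgeUnion-⁅⁆ a) (edgeUnion-⁅i,j,k⁆ b c d))
    where open Distinct4 q

  tripleSpan : ∀ {v i j k} → GFree E v 3 → i ≢ j → i ≢ k → j ≢ k →
    v + 1 ≤ ∣ E i ∪ (E j ∪ E k) ∣
  tripleSpan {v} {i} {j} {k} free i≢j i≢k j≢k =
    subst (λ U → v + 1 ≤ ∣ U ∣) (edgeUnion-⁅i,j,k⁆ i j k) (free _ (∣⁅i,j,k⁆∣ i≢j i≢k j≢k))

m∸[1+k]+1+k≡m : ∀ {m k} → suc k ≤ m → m ∸ suc k + 1 + k ≡ m
m∸[1+k]+1+k≡m {m} {k} 1+k≤m = trans (+-assoc (m ∸ suc k) 1 k) (m∸n+n≡m 1+k≤m)

∸-bound⇒ : ∀ {m k x} → suc k ≤ m → m ∸ suc k + 1 ≤ x → m ≤ x + k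
∸-bound⇒ {k = k} 1+k≤m bound =
  subst (_≤ _ + k) (m∸[1+k]+1+k≡m 1+k≤m) (+-monoˡ-≤ k bound)

⇒∸-bound : ∀ {m k x} → suc k ≤ m → m ≤ x + k → m ∸ suc k + 1 ≤ x
⇒∸-bound {m} {k} {x} 1+k≤m bound =
  +-cancelʳ-≤ k (m ∸ suc k + 1) x (subst (_≤ x + k) (sym (m∸[1+k]+1+k≡m 1+k≤m)) bound)

theorem12 : (r n m : ℕ) (E : Fin m → Subset n) → 3 ≤ r →
    DistinctEdges E → Uniform r E → Partite r E → Linear E →
    GFree E (3 * r ∸ 3) 3 → GFree E (4 * r ∸ 5) 4
theorem12 r n m E 3≤r _ uniform _ linear free₃ S ∣S∣≡4 with split4 S ∣S∣≡4
... | q , refl =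
  ⇒∸-bound 5≤4r (subst (λ U → 4 * r ≤ ∣ U ∣ + 4) (sym (edgeUnion-Distinct4 E q)) bound)
  where
  open Distinct4 q
  3≤3r : 3 ≤ 3 * r
  3≤3r = ≤-trans (m≤m+n 3 6) (*-monoʳ-≤ 3 3≤r)
  5≤4r : 5 ≤ 4 * r
  5≤4r = ≤-trans (m≤m+n 5 7) (*-monoʳ-≤ 4 3≤r)
  spread : ∀ {i j k} → i ≢ j → i ≢ k → j ≢ k → 3 * r ≤ ∣ E i ∪ (E j ∪ E k) ∣ + 2
  spread i≢j i≢k j≢k = ∸-bound⇒ 3≤3r (tripleSpan E free₃ i≢j i≢k j≢k)
  open FourSets r (E a) (E b) (E c) (E d) (uniform a) (uniform b) (uniform c) (uniform d)
    (linear a b a≢b) (linear a c a≢c) (linear a d a≢d)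
    (spread b≢c b≢d c≢d) (spread a≢b a≢c b≢c) (spread a≢b a≢d b≢d) (spread a≢c a≢d c≢d)
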